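{- Let $T^*$ be a theory in the language of category theory plus constants whose constants form a set, let $M$ be a model for $T^*$, and let $FP=FP_{T^*,M}$. Then the set $\{\phi\mid FP(\phi)\}$ of sentences is closed under logical deduction: if sentences $\phi_1,\dots,\phi_n$ satisfy $FP(\phi_i)$ for all $i$ and $\psi$ is derivable from $\phi_1,\dots,\phi_n$ in intuitionistic (natural deduction) dependently sorted logic together with the axioms that each equality $=$ is an equivalence relation preserved by composition, then $FP(\psi)$.
   Context: The language of category theory is a dependently sorted first-order language with an object sort, arrow sorts $X\to Y$, identities $1_X$, composition, atomic formulas $f=g$ only for arrow-terms of the same sort, connectives $\wedge,\vee,\to,\top,\bot$ and sorted quantifiers; theories may have object and arrow constants. A model for $T^*$ is a set $M$ of atomic sentences $f_1=f_2$ between closed arrow-terms of the same sort such that (1) $T^*\vdash f_1=f_2$ for each member; (2) for object constants $S_1,S_2$, membership in $M$ is an equivalence relation on closed arrow-terms $S_1\to S_2$; (3) $M$ is closed under composing equal pairs: $(f_1=f_2),(g_1=g_2)\in M$ implies $(g_1\circ f_1=g_2\circ f_2)\in M$. $FP$ is defined recursively on sentences: $FP(f_1=f_2)$ iff $(f_1=f_2)\in M$; $FP$ commutes with $\wedge,\vee$; $FP(\phi\to\xi)$ iff ($FP(\phi)\Rightarrow FP(\xi)$) and $T^*\vdash\phi\to\xi$; $FP(\top)$ true, $FP(\bot)$ false; $FP(\exists x{:}W\,P(x))$ iff $FP(P(t))$ for some closed term $t$ of sort $W$; $FP(\forall x{:}W\,P(x))$ iff $FP(P(t))$ for every closed term $t$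 of sort $W$ and $T^*\vdash\forall x{:}W\,P(x)$. -}

module Defs where

open import Data.Nat using (ℕ; zero; suc; _+_)
open import Data.List using (List; []; _∷_; map)
open import Data.List.Membership.Propositional using (_∈_)
open import Data.Product using (Σ; _×_; _,_; ∃₂)
open import Data.Sum using (_⊎_)
open import Data.Empty using (⊥)
open import Data.Unit using (⊤)

-- A signature: the language of category theory plus constants.
-- The constants form a set (small types ObjC, ArrC); every arrow constant
-- has a sort  dom a → cod a  between object constants.
record Sig : Set₁ where
  field
    ObjC : Set
    ArrC : Set
    dom cod : ArrC → ObjC

module _ (S : Sig) where
  open Sig S

  -- Raw syntax (de Bruijn indices; one index space shared by object and
  -- arrow variables, since quantifiers of both kinds interleave).

  data Tm : Set where
    var  : ℕ → Tm
    ocon : ObjC → Tm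
    acon : ArrC → Tm
    idt  : Tm → Tm
    comp : Tm → Tm → Tm     -- comp g f  =  g ∘ f

  data Sort : Set where
    obj : Sort
    arr : Tm → Tm → Sort

  infix  4 _≐_
  infixr 6 _∧'_
  infixr 5 _∨'_
  infixr 4 _⇒'_

  data Fm : Set where
    _≐_  : Tm → Tm → Fm
    ⊤'   : Fm
    ⊥'   : Fm
    _∧'_ : Fm → Fm → Fm
    _∨'_ : Fm → Fm → Fm
    _⇒'_ : Fm → Fm → Fm
    all  : Sort → Fm → Fm   -- ∀ x : W . P   (x is index 0 in P)
    ex   : Sort → Fm → Fm

  ext : (ℕ → ℕ) → ℕ → ℕ
  ext ρ zero    = zero
  ext ρ (suc n) = suc (ρ n)

  renT : (ℕ → ℕ) → Tm → Tm
  renT ρ (var n)    = var (ρ n)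
  renT ρ (ocon c)   = ocon c
  renT ρ (acon a)   = acon a
  renT ρ (idt X)    = idt (renT ρ X)
  renT ρ (comp g f) = comp (renT ρ g) (renT ρ f)

  renS : (ℕ → ℕ) → Sort → Sort
  renS ρ obj       = obj
  renS ρ (arr X Y) = arr (renT ρ X) (renT ρ Y)

  renF : (ℕ → ℕ) → Fm → Fm
  renF ρ (f ≐ g)   = renT ρ f ≐ renT ρ g
  renF ρ ⊤'        = ⊤'
  renF ρ ⊥'        = ⊥'
  renF ρ (φ ∧' ψ)  = renF ρ φ ∧' renF ρ ψ
  renF ρ (φ ∨' ψ)  = renF ρ φ ∨' renF ρ ψ
  renF ρ (φ ⇒' ψ)  = renF ρ φ ⇒' renF ρ ψ
  renF ρ (all W P) = all (renS ρ W) (renF (ext ρ) P)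
  renF ρ (ex W P)  = ex (renS ρ W) (renF (ext ρ) P)

  exts : (ℕ → Tm) → ℕ → Tm
  exts σ zero    = var zero
  exts σ (suc n) = renT suc (σ n)

  subT : (ℕ → Tm) → Tm → Tm
  subT σ (var n)    = σ n
  subT σ (ocon c)   = ocon c
  subT σ (acon a)   = acon a
  subT σ (idt X)    = idt (subT σ X)
  subT σ (comp g f) = comp (subT σ g) (subT σ f)

  subS : (ℕ → Tm) → Sort → Sort
  subS σ obj       = obj
  subS σ (arr X Y) = arr (subT σ X) (subT σ Y)

  subF : (ℕ → Tm) → Fm → Fm
  subF σ (f ≐ g)   = subT σ f ≐ subT σ g
  subF σ ⊤'        = ⊤'
  subF σ ⊥'        = ⊥'
  subF σ (φ ∧' ψ)  = subF σ φ ∧' subF σ ψ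
  subF σ (φ ∨' ψ)  = subF σ φ ∨' subF σ ψ
  subF σ (φ ⇒' ψ)  = subF σ φ ⇒' subF σ ψ
  subF σ (all W P) = all (subS σ W) (subF (exts σ) P)
  subF σ (ex W P)  = ex (subS σ W) (subF (exts σ) P)

  sub0 : Tm → ℕ → Tm
  sub0 t zero    = t
  sub0 t (suc n) = var n

  _[_] : Fm → Tm → Fm
  P [ t ] = subF (sub0 t) P

  wkF : Fm → Fm
  wkF = renF suc

  -- Sorting.  A context lists the sorts of the variables, index 0 first;
  -- the sort at position i may mention the variables after it.

  Ctx : Set
  Ctx = List Sort

  infix 3 _∋_∶_ _⊢_∶_ _⊢s_ _⊢wf_

  data _∋_∶_ : Ctx → ℕ → Sort → Set where
    here  : ∀ {Γ W} → (W ∷ Γ) ∋ zero ∶ renS suc W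
    there : ∀ {Γ W W' i} → Γ ∋ i ∶ W → (W' ∷ Γ) ∋ suc i ∶ renS suc W

  data _⊢_∶_ (Γ : Ctx) : Tm → Sort → Set where
    var  : ∀ {i W} → Γ ∋ i ∶ W → Γ ⊢ var i ∶ W
    ocon : ∀ c → Γ ⊢ ocon c ∶ obj
    acon : ∀ a → Γ ⊢ acon a ∶ arr (ocon (dom a)) (ocon (cod a))
    idt  : ∀ {X} → Γ ⊢ X ∶ obj → Γ ⊢ idt X ∶ arr X X
    comp : ∀ {f g X Y Z} → Γ ⊢ f ∶ arr X Y → Γ ⊢ g ∶ arr Y Z
         → Γ ⊢ comp g f ∶ arr X Z

  data _⊢s_ (Γ : Ctx) : Sort → Set where
    obj : Γ ⊢s obj
    arr : ∀ {X Y} → Γ ⊢ X ∶ obj → Γ ⊢ Y ∶ obj → Γ ⊢s arr X Y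

  data _⊢wf_ (Γ : Ctx) : Fm → Set where
    eq  : ∀ {f g X Y} → Γ ⊢ f ∶ arr X Y → Γ ⊢ g ∶ arr X Y → Γ ⊢wf f ≐ g
    top : Γ ⊢wf ⊤'
    bot : Γ ⊢wf ⊥'
    and : ∀ {φ ψ} → Γ ⊢wf φ → Γ ⊢wf ψ → Γ ⊢wf φ ∧' ψ
    or  : ∀ {φ ψ} → Γ ⊢wf φ → Γ ⊢wf ψ → Γ ⊢wf φ ∨' ψ
    imp : ∀ {φ ψ} → Γ ⊢wf φ → Γ ⊢wf ψ → Γ ⊢wf φ ⇒' ψ
    all : ∀ {W P} → Γ ⊢s W → (W ∷ Γ) ⊢wf P → Γ ⊢wf all W P
    ex  : ∀ {W P} → Γ ⊢s W → (W ∷ Γ) ⊢wf P → Γ ⊢wf ex W P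

  Sentence : Fm → Set
  Sentence φ = [] ⊢wf φ

  -- Der A Γ Φ φ : φ is derivable in context Γ from the local hypotheses Φ
  -- and the (closed) global axioms A.

  data Der (A : Fm → Set) : Ctx → List Fm → Fm → Set where
    hyp  : ∀ {Γ Φ φ} → φ ∈ Φ → Der A Γ Φ φ
    ax   : ∀ {Γ Φ φ} → A φ → Der A Γ Φ φ
    ⊤I   : ∀ {Γ Φ} → Der A Γ Φ ⊤'
    ⊥E   : ∀ {Γ Φ φ} → Γ ⊢wf φ → Der A Γ Φ ⊥' → Der A Γ Φ φ
    ∧I   : ∀ {Γ Φ φ ψ} → Der A Γ Φ φ → Der A Γ Φ ψ → Der A Γ Φ (φ ∧' ψ)
    ∧E₁  : ∀ {Γ Φ φ ψ} → Der A Γ Φ (φ ∧' ψ) → Der A Γ Φ φ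
    ∧E₂  : ∀ {Γ Φ φ ψ} → Der A Γ Φ (φ ∧' ψ) → Der A Γ Φ ψ
    ∨I₁  : ∀ {Γ Φ φ ψ} → Γ ⊢wf ψ → Der A Γ Φ φ → Der A Γ Φ (φ ∨' ψ)
    ∨I₂  : ∀ {Γ Φ φ ψ} → Γ ⊢wf φ → Der A Γ Φ ψ → Der A Γ Φ (φ ∨' ψ)
    ∨E   : ∀ {Γ Φ φ ψ χ} → Der A Γ Φ (φ ∨' ψ)
         → Der A Γ (φ ∷ Φ) χ → Der A Γ (ψ ∷ Φ) χ → Der A Γ Φ χ
    ⇒I   : ∀ {Γ Φ φ ψ} → Γ ⊢wf φ → Der A Γ (φ ∷ Φ) ψ → Der A Γ Φ (φ ⇒' ψ)
    ⇒E   : ∀ {Γ Φ φ ψ} → Der A Γ Φ (φ ⇒' ψ) → Der A Γ Φ φ → Der A Γ Φ ψ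
    ∀I   : ∀ {Γ Φ W P} → Γ ⊢s W → Der A (W ∷ Γ) (map wkF Φ) P
         → Der A Γ Φ (all W P)
    ∀E   : ∀ {Γ Φ W P t} → Der A Γ Φ (all W P) → Γ ⊢ t ∶ W
         → Der A Γ Φ (P [ t ])
    ∃I   : ∀ {Γ Φ W P t} → Γ ⊢s W → (W ∷ Γ) ⊢wf P → Γ ⊢ t ∶ W
         → Der A Γ Φ (P [ t ]) → Der A Γ Φ (ex W P)
    ∃E   : ∀ {Γ Φ W P χ} → Der A Γ Φ (ex W P) → Γ ⊢wf χ
         → Der A (W ∷ Γ) (P ∷ map wkF Φ) (wkF χ) → Der A Γ Φ χ
    ≐refl  : ∀ {Γ Φ f X Y} → Γ ⊢ f ∶ arr X Y → Der A Γ Φ (f ≐ f)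
    ≐sym   : ∀ {Γ Φ f g} → Der A Γ Φ (f ≐ g) → Der A Γ Φ (g ≐ f)
    ≐trans : ∀ {Γ Φ f g h} → Der A Γ Φ (f ≐ g) → Der A Γ Φ (g ≐ h)
           → Der A Γ Φ (f ≐ h)
    ≐comp  : ∀ {Γ Φ f₁ f₂ g₁ g₂ X Y Z} → Γ ⊢ f₁ ∶ arr X Y → Γ ⊢ g₁ ∶ arr Y Z
           → Der A Γ Φ (f₁ ≐ f₂) → Der A Γ Φ (g₁ ≐ g₂)
           → Der A Γ Φ (comp g₁ f₁ ≐ comp g₂ f₂)

  _⊢T_ : (Fm → Set) → Fm → Set
  T ⊢T φ = Der T [] [] φ

  NoAxioms : Fm → Set
  NoAxioms _ = ⊥

  -- Models for T*.  M f₁ f₂ means that the atomic sentence f₁ = f₂ is in M.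

  record Model (T : Fm → Set) : Set₁ where
    field
      M      : Tm → Tm → Set
      sorted : ∀ {f₁ f₂} → M f₁ f₂
             → ∃₂ λ X Y → ([] ⊢ f₁ ∶ arr X Y) × ([] ⊢ f₂ ∶ arr X Y)
      prov   : ∀ {f₁ f₂} → M f₁ f₂ → T ⊢T (f₁ ≐ f₂)
      M-refl : ∀ (S₁ S₂ : ObjC) f → [] ⊢ f ∶ arr (ocon S₁) (ocon S₂) → M f f
      M-sym  : ∀ (S₁ S₂ : ObjC) f g
             → [] ⊢ f ∶ arr (ocon S₁) (ocon S₂) → [] ⊢ g ∶ arr (ocon S₁) (ocon S₂)
             → M f g → M g f
      M-trans : ∀ (S₁ S₂ : ObjC) f g h
             → [] ⊢ f ∶ arr (ocon S₁) (ocon S₂) → [] ⊢ g ∶ arr (ocon S₁) (ocon S₂)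
             → [] ⊢ h ∶ arr (ocon S₁) (ocon S₂)
             → M f g → M g h → M f h
      M-comp : ∀ {f₁ f₂ g₁ g₂ X Y Z} → [] ⊢ f₁ ∶ arr X Y → [] ⊢ g₁ ∶ arr Y Z
             → M f₁ f₂ → M g₁ g₂ → M (comp g₁ f₁) (comp g₂ f₂)

  -- FP.  The recursion goes through P(t), which is not a subformula, so it
  -- is made structural with a fuel argument equal to the size of the
  -- formula (substitution preserves size).

  size : Fm → ℕ
  size (f ≐ g)   = 1
  size ⊤'        = 1
  size ⊥'        = 1
  size (φ ∧' ψ)  = suc (size φ + size ψ)
  size (φ ∨' ψ)  = suc (size φ + size ψ)
  size (φ ⇒' ψ)  = suc (size φ + size ψ)
  size (all W P) = suc (size P)
  size (ex W P)  = suc (size P)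

  module _ (T : Fm → Set) (Mo : Model T) where
    open Model Mo using (M)

    FPf : ℕ → Fm → Set
    FPf zero    _         = ⊥
    FPf (suc n) (f ≐ g)   = M f g
    FPf (suc n) ⊤'        = ⊤
    FPf (suc n) ⊥'        = ⊥
    FPf (suc n) (φ ∧' ψ)  = FPf n φ × FPf n ψ
    FPf (suc n) (φ ∨' ψ)  = FPf n φ ⊎ FPf n ψ
    FPf (suc n) (φ ⇒' ψ)  = (FPf n φ → FPf n ψ) × (T ⊢T (φ ⇒' ψ))
    FPf (suc n) (all W P) = ((t : Tm) → [] ⊢ t ∶ W → FPf n (P [ t ])) × (T ⊢T all W P)
    FPf (suc n) (ex W P)  = Σ Tm λ t → ([] ⊢ t ∶ W) × FPf n (P [ t ])

    FP : Fm → Set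
    FP φ = FPf (size φ) φ

module Submission where

-- A derivation
-- passes through open formulas, so the induction hypothesis speaks about every
-- closing substitution σ that is well sorted and forces the current hypotheses: the
-- conclusion, instantiated by σ, is then forced. Since the quantifier clauses of FP
-- range over closed terms, ∀I and ∃E are the induction hypothesis at the extended
-- substitution t ∷ σ. The ⇒ and ∀ clauses of FP also ask for T*-provability of the
-- instance; it holds because every forced sentence is T*-provable, so the
-- hypotheses of the σ-instance of the derivation can be discharged by ⇒I and cut
-- by ⇒E. The equality rules hold because closed arrow terms have sorts between
-- object constants, on which M is an equivalence relation closed under composition.

open import Data.Empty using (⊥-elim)
open import Data.List using (List; []; _∷_; map)
open import Data.List.Properties using (map-∘; map-cong)
open import Data.List.Relation.Unary.All as All using (All; []; _∷_)
open import Data.List.Relation.Unary.All.Properties using (map⁺)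
open import Data.List.Membership.Propositional.Properties using (∈-map⁺)
open import Data.Nat using (ℕ; zero; suc; _+_; _≤_; s≤s)
open import Data.Nat.Properties using (≤-refl; ≤-reflexive; ≤-trans; m≤m+n; m≤n+m; m+n≤o⇒m≤o; m+n≤o⇒n≤o)
open import Data.Product using (Σ; ∃₂; _×_; _,_; proj₁; proj₂)
open import Data.Sum as Sum using (_⊎_; inj₁; inj₂)
open import Data.Unit using (tt)
open import Function using (_∘_; id; _⇔_; mk⇔; Equivalence)
open import Relation.Binary.PropositionalEquality using (_≡_; refl; sym; trans; cong; cong₂; subst; subst₂; _≗_; module ≡-Reasoning)
open import Defs using (Sig; module Sig; var; ocon; acon; idt; comp; obj; arr; _≐_; ⊤'; ⊥'; _∧'_; _∨'_; _⇒'_; all; ex; here; there; eq; top; bot; and; or; imp; hyp; ax; ⊤I; ⊥E; ∧I; ∧E₁; ∧E₂; ∨I₁; ∨I₂; ∨E; ⇒I; ⇒E; ∀I; ∀E; ∃I; ∃E; ≐refl; ≐sym; ≐trans; ≐comp)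
import Defs as D

module Soundness (S : Sig) where
  open Sig S

  Tm : Set
  Tm = D.Tm S

  Sort : Set
  Sort = D.Sort S

  Fm : Set
  Fm = D.Fm S

  Ctx : Set
  Ctx = D.Ctx S

  ext : (ℕ → ℕ) → ℕ → ℕ
  ext = D.ext S

  renT : (ℕ → ℕ) → Tm → Tm
  renT = D.renT S

  renS : (ℕ → ℕ) → Sort → Sort
  renS = D.renS S

  renF : (ℕ → ℕ) → Fm → Fm
  renF = D.renF S

  exts : (ℕ → Tm) → ℕ → Tm
  exts = D.exts S

  subT : (ℕ → Tm) → Tm → Tm
  subT = D.subT S

  subS : (ℕ → Tm) → Sort → Sort
  subS = D.subS S

  subF : (ℕ → Tm) → Fm → Fm
  subF = D.subF S

  sub0 : Tm → ℕ → Tm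
  sub0 = D.sub0 S

  _[_] : Fm → Tm → Fm
  _[_] = D._[_] S

  wkF : Fm → Fm
  wkF = D.wkF S

  size : Fm → ℕ
  size = D.size S

  infix 3 _∋_∶_ _⊢_∶_ _⊢s_ _⊢wf_

  _∋_∶_ : Ctx → ℕ → Sort → Set
  _∋_∶_ = D._∋_∶_ S

  _⊢_∶_ : Ctx → Tm → Sort → Set
  _⊢_∶_ = D._⊢_∶_ S

  _⊢s_ : Ctx → Sort → Set
  _⊢s_ = D._⊢s_ S

  _⊢wf_ : Ctx → Fm → Set
  _⊢wf_ = D._⊢wf_ S

  Der : (Fm → Set) → Ctx → List Fm → Fm → Set
  Der = D.Der S

  NoAxioms : Fm → Set
  NoAxioms = D.NoAxioms S

  private variable
    Γ Δ : Ctx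
    Φ : List Fm
    φ ψ P : Fm
    W W′ : Sort
    t f g h X Y : Tm
    σ τ : ℕ → Tm
    A A′ : Fm → Set
    m n : ℕ

  ren : (ℕ → ℕ) → ℕ → Tm
  ren ρ n = var (ρ n)

  infixr 5 _∷ˢ_

  _∷ˢ_ : Tm → (ℕ → Tm) → ℕ → Tm
  (t ∷ˢ σ) zero    = t
  (t ∷ˢ σ) (suc n) = σ n

  subT-cong : σ ≗ τ → subT σ ≗ subT τ
  subT-cong e (var n)    = e n
  subT-cong e (ocon c)   = refl
  subT-cong e (acon a)   = refl
  subT-cong e (idt X)    = cong idt (subT-cong e X)
  subT-cong e (comp g f) = cong₂ comp (subT-cong e g) (subT-cong e f)

  renT-as-subT : ∀ ρ → renT ρ ≗ subT (ren ρ)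
  renT-as-subT ρ (var n)    = refl
  renT-as-subT ρ (ocon c)   = refl
  renT-as-subT ρ (acon a)   = refl
  renT-as-subT ρ (idt X)    = cong idt (renT-as-subT ρ X)
  renT-as-subT ρ (comp g f) = cong₂ comp (renT-as-subT ρ g) (renT-as-subT ρ f)

  subT-subT : ∀ σ τ t → subT σ (subT τ t) ≡ subT (subT σ ∘ τ) t
  subT-subT σ τ (var n)    = refl
  subT-subT σ τ (ocon c)   = refl
  subT-subT σ τ (acon a)   = refl
  subT-subT σ τ (idt X)    = cong idt (subT-subT σ τ X)
  subT-subT σ τ (comp g f) = cong₂ comp (subT-subT σ τ g) (subT-subT σ τ f)

  subT-id : subT var ≗ id
  subT-id (var n)    = refl
  subT-id (ocon c)   = refl
  subT-id (acon a)   = refl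
  subT-id (idt X)    = cong idt (subT-id X)
  subT-id (comp g f) = cong₂ comp (subT-id g) (subT-id f)

  subT-wk : ∀ σ t → subT σ (renT suc t) ≡ subT (σ ∘ suc) t
  subT-wk σ t = trans (cong (subT σ) (renT-as-subT suc t)) (subT-subT σ (ren suc) t)

  subT-exts-wk : ∀ σ t → subT (exts σ) (renT suc t) ≡ renT suc (subT σ t)
  subT-exts-wk σ t = begin
    subT (exts σ) (renT suc t)   ≡⟨ subT-wk (exts σ) t ⟩
    subT (renT suc ∘ σ) t        ≡⟨ subT-cong (renT-as-subT suc ∘ σ) t ⟩
    subT (subT (ren suc) ∘ σ) t  ≡⟨ subT-subT (ren suc) σ t ⟨
    subT (ren suc) (subT σ t)    ≡⟨ renT-as-subT suc (subT σ t) ⟨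
    renT suc (subT σ t)          ∎
    where open ≡-Reasoning

  exts-cong : σ ≗ τ → exts σ ≗ exts τ
  exts-cong e zero    = refl
  exts-cong e (suc n) = cong (renT suc) (e n)

  exts-∘ : ∀ σ τ → subT (exts σ) ∘ exts τ ≗ exts (subT σ ∘ τ)
  exts-∘ σ τ zero    = refl
  exts-∘ σ τ (suc n) = subT-exts-wk σ (τ n)

  exts-ren : ∀ ρ → ren (ext ρ) ≗ exts (ren ρ)
  exts-ren ρ zero    = refl
  exts-ren ρ (suc n) = refl

  exts-id : exts var ≗ var
  exts-id zero    = refl
  exts-id (suc n) = refl

  subS-cong : σ ≗ τ → subS σ ≗ subS τ
  subS-cong e obj       = refl
  subS-cong e (arr X Y) = cong₂ arr (subT-cong e X) (subT-cong e Y)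

  renS-as-subS : ∀ ρ → renS ρ ≗ subS (ren ρ)
  renS-as-subS ρ obj       = refl
  renS-as-subS ρ (arr X Y) = cong₂ arr (renT-as-subT ρ X) (renT-as-subT ρ Y)

  subS-subS : ∀ σ τ W → subS σ (subS τ W) ≡ subS (subT σ ∘ τ) W
  subS-subS σ τ obj       = refl
  subS-subS σ τ (arr X Y) = cong₂ arr (subT-subT σ τ X) (subT-subT σ τ Y)

  subS-id : subS var ≗ id
  subS-id obj       = refl
  subS-id (arr X Y) = cong₂ arr (subT-id X) (subT-id Y)

  subS-wk : ∀ σ W → subS σ (renS suc W) ≡ subS (σ ∘ suc) W
  subS-wk σ W = trans (cong (subS σ) (renS-as-subS suc W)) (subS-subS σ (ren suc) W)

  subS-exts-wk : ∀ σ W → subS (exts σ) (renS suc W) ≡ renS suc (subS σ W)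
  subS-exts-wk σ obj       = refl
  subS-exts-wk σ (arr X Y) = cong₂ arr (subT-exts-wk σ X) (subT-exts-wk σ Y)

  subS-sub0-wk : ∀ t W → subS (sub0 t) (renS suc W) ≡ W
  subS-sub0-wk t W = trans (subS-wk (sub0 t) W) (subS-id W)

  subF-cong : σ ≗ τ → subF σ ≗ subF τ
  subF-cong e (f ≐ g)   = cong₂ _≐_ (subT-cong e f) (subT-cong e g)
  subF-cong e ⊤'        = refl
  subF-cong e ⊥'        = refl
  subF-cong e (φ ∧' ψ)  = cong₂ _∧'_ (subF-cong e φ) (subF-cong e ψ)
  subF-cong e (φ ∨' ψ)  = cong₂ _∨'_ (subF-cong e φ) (subF-cong e ψ)
  subF-cong e (φ ⇒' ψ)  = cong₂ _⇒'_ (subF-cong e φ) (subF-cong e ψ)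
  subF-cong e (all W P) = cong₂ all (subS-cong e W) (subF-cong (exts-cong e) P)
  subF-cong e (ex W P)  = cong₂ ex (subS-cong e W) (subF-cong (exts-cong e) P)

  renF-as-subF : ∀ ρ → renF ρ ≗ subF (ren ρ)
  renF-as-subF ρ (f ≐ g)   = cong₂ _≐_ (renT-as-subT ρ f) (renT-as-subT ρ g)
  renF-as-subF ρ ⊤'        = refl
  renF-as-subF ρ ⊥'        = refl
  renF-as-subF ρ (φ ∧' ψ)  = cong₂ _∧'_ (renF-as-subF ρ φ) (renF-as-subF ρ ψ)
  renF-as-subF ρ (φ ∨' ψ)  = cong₂ _∨'_ (renF-as-subF ρ φ) (renF-as-subF ρ ψ)
  renF-as-subF ρ (φ ⇒' ψ)  = cong₂ _⇒'_ (renF-as-subF ρ φ) (renF-as-subF ρ ψ)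
  renF-as-subF ρ (all W P) = cong₂ all (renS-as-subS ρ W)
    (trans (renF-as-subF (ext ρ) P) (subF-cong (exts-ren ρ) P))
  renF-as-subF ρ (ex W P)  = cong₂ ex (renS-as-subS ρ W)
    (trans (renF-as-subF (ext ρ) P) (subF-cong (exts-ren ρ) P))

  subF-subF : ∀ σ τ φ → subF σ (subF τ φ) ≡ subF (subT σ ∘ τ) φ
  subF-subF σ τ (f ≐ g)   = cong₂ _≐_ (subT-subT σ τ f) (subT-subT σ τ g)
  subF-subF σ τ ⊤'        = refl
  subF-subF σ τ ⊥'        = refl
  subF-subF σ τ (φ ∧' ψ)  = cong₂ _∧'_ (subF-subF σ τ φ) (subF-subF σ τ ψ)
  subF-subF σ τ (φ ∨' ψ)  = cong₂ _∨'_ (subF-subF σ τ φ) (subF-subF σ τ ψ)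
  subF-subF σ τ (φ ⇒' ψ)  = cong₂ _⇒'_ (subF-subF σ τ φ) (subF-subF σ τ ψ)
  subF-subF σ τ (all W P) = cong₂ all (subS-subS σ τ W)
    (trans (subF-subF (exts σ) (exts τ) P) (subF-cong (exts-∘ σ τ) P))
  subF-subF σ τ (ex W P)  = cong₂ ex (subS-subS σ τ W)
    (trans (subF-subF (exts σ) (exts τ) P) (subF-cong (exts-∘ σ τ) P))

  subF-id : subF var ≗ id
  subF-id (f ≐ g)   = cong₂ _≐_ (subT-id f) (subT-id g)
  subF-id ⊤'        = refl
  subF-id ⊥'        = refl
  subF-id (φ ∧' ψ)  = cong₂ _∧'_ (subF-id φ) (subF-id ψ)
  subF-id (φ ∨' ψ)  = cong₂ _∨'_ (subF-id φ) (subF-id ψ)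
  subF-id (φ ⇒' ψ)  = cong₂ _⇒'_ (subF-id φ) (subF-id ψ)
  subF-id (all W P) = cong₂ all (subS-id W) (trans (subF-cong exts-id P) (subF-id P))
  subF-id (ex W P)  = cong₂ ex (subS-id W) (trans (subF-cong exts-id P) (subF-id P))

  subF-wk : ∀ σ φ → subF σ (wkF φ) ≡ subF (σ ∘ suc) φ
  subF-wk σ φ = trans (cong (subF σ) (renF-as-subF suc φ)) (subF-subF σ (ren suc) φ)

  subF-exts-wk : ∀ σ φ → subF (exts σ) (wkF φ) ≡ wkF (subF σ φ)
  subF-exts-wk σ φ = begin
    subF (exts σ) (wkF φ)        ≡⟨ subF-wk (exts σ) φ ⟩
    subF (renT suc ∘ σ) φ        ≡⟨ subF-cong (renT-as-subT suc ∘ σ) φ ⟩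
    subF (subT (ren suc) ∘ σ) φ  ≡⟨ subF-subF (ren suc) σ φ ⟨
    subF (ren suc) (subF σ φ)    ≡⟨ renF-as-subF suc (subF σ φ) ⟨
    wkF (subF σ φ)               ∎
    where open ≡-Reasoning

  map-subF-exts-wk : ∀ σ Φ → map (subF (exts σ)) (map wkF Φ) ≡ map wkF (map (subF σ) Φ)
  map-subF-exts-wk σ Φ = begin
    map (subF (exts σ)) (map wkF Φ)  ≡⟨ map-∘ Φ ⟨
    map (subF (exts σ) ∘ wkF) Φ      ≡⟨ map-cong (subF-exts-wk σ) Φ ⟩
    map (wkF ∘ subF σ) Φ             ≡⟨ map-∘ Φ ⟩
    map wkF (map (subF σ) Φ)         ∎
    where open ≡-Reasoning

  subF-exts-sub0 : ∀ t σ P → subF (exts σ) P [ t ] ≡ subF (t ∷ˢ σ) P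
  subF-exts-sub0 t σ P = trans (subF-subF (sub0 t) (exts σ) P) (subF-cong pointwise P)
    where
    pointwise : subT (sub0 t) ∘ exts σ ≗ t ∷ˢ σ
    pointwise zero    = refl
    pointwise (suc n) = trans (subT-wk (sub0 t) (σ n)) (subT-id (σ n))

  subF-sub0 : ∀ σ t P → subF σ (P [ t ]) ≡ subF (exts σ) P [ subT σ t ]
  subF-sub0 σ t P = begin
    subF σ (P [ t ])              ≡⟨ subF-subF σ (sub0 t) P ⟩
    subF (subT σ ∘ sub0 t) P      ≡⟨ subF-cong pointwise P ⟩
    subF (subT σ t ∷ˢ σ) P        ≡⟨ subF-exts-sub0 (subT σ t) σ P ⟨
    subF (exts σ) P [ subT σ t ]  ∎
    where
    open ≡-Reasoning
    pointwise : subT σ ∘ sub0 t ≗ subT σ t ∷ˢ σ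
    pointwise zero    = refl
    pointwise (suc n) = refl

  size-subF : ∀ σ φ → size (subF σ φ) ≡ size φ
  size-subF σ (f ≐ g)   = refl
  size-subF σ ⊤'        = refl
  size-subF σ ⊥'        = refl
  size-subF σ (φ ∧' ψ)  = cong suc (cong₂ _+_ (size-subF σ φ) (size-subF σ ψ))
  size-subF σ (φ ∨' ψ)  = cong suc (cong₂ _+_ (size-subF σ φ) (size-subF σ ψ))
  size-subF σ (φ ⇒' ψ)  = cong suc (cong₂ _+_ (size-subF σ φ) (size-subF σ ψ))
  size-subF σ (all W P) = cong suc (size-subF (exts σ) P)
  size-subF σ (ex W P)  = cong suc (size-subF (exts σ) P)

  size-[]-≤ : ∀ P → size P ≤ n → size (P [ t ]) ≤ n
  size-[]-≤ {t = t} P = ≤-trans (≤-reflexive (size-subF (sub0 t) P))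

  infix 3 _⊢ₛ_∶_

  _⊢ₛ_∶_ : Ctx → (ℕ → Tm) → Ctx → Set
  Γ ⊢ₛ σ ∶ Δ = ∀ {i V} → Δ ∋ i ∶ V → Γ ⊢ σ i ∶ subS σ V

  ⊢-renT-suc : Γ ⊢ t ∶ W → (W′ ∷ Γ) ⊢ renT suc t ∶ renS suc W
  ⊢-renT-suc (var x)      = var (there x)
  ⊢-renT-suc (ocon c)     = ocon c
  ⊢-renT-suc (acon a)     = acon a
  ⊢-renT-suc (idt ⊢X)     = idt (⊢-renT-suc ⊢X)
  ⊢-renT-suc (comp ⊢f ⊢g) = comp (⊢-renT-suc ⊢f) (⊢-renT-suc ⊢g)

  ⊢-subT : Γ ⊢ₛ σ ∶ Δ → Δ ⊢ t ∶ W → Γ ⊢ subT σ t ∶ subS σ W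
  ⊢-subT ⊢σ (var x)      = ⊢σ x
  ⊢-subT ⊢σ (ocon c)     = ocon c
  ⊢-subT ⊢σ (acon a)     = acon a
  ⊢-subT ⊢σ (idt ⊢X)     = idt (⊢-subT ⊢σ ⊢X)
  ⊢-subT ⊢σ (comp ⊢f ⊢g) = comp (⊢-subT ⊢σ ⊢f) (⊢-subT ⊢σ ⊢g)

  ⊢s-subS : Γ ⊢ₛ σ ∶ Δ → Δ ⊢s W → Γ ⊢s subS σ W
  ⊢s-subS ⊢σ obj         = obj
  ⊢s-subS ⊢σ (arr ⊢X ⊢Y) = arr (⊢-subT ⊢σ ⊢X) (⊢-subT ⊢σ ⊢Y)

  ⊢ₛ-exts : Γ ⊢ₛ σ ∶ Δ → (subS σ W ∷ Γ) ⊢ₛ exts σ ∶ (W ∷ Δ)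
  ⊢ₛ-exts {Γ = Γ} {σ = σ} {W = W} ⊢σ here =
    subst (subS σ W ∷ Γ ⊢ var zero ∶_) (sym (subS-exts-wk σ W)) (var here)
  ⊢ₛ-exts {σ = σ} ⊢σ (there {W = W′} x) =
    subst (_ ⊢ renT suc (σ _) ∶_) (sym (subS-exts-wk σ W′)) (⊢-renT-suc (⊢σ x))

  ⊢wf-subF : Γ ⊢ₛ σ ∶ Δ → Δ ⊢wf φ → Γ ⊢wf subF σ φ
  ⊢wf-subF ⊢σ (eq ⊢f ⊢g)  = eq (⊢-subT ⊢σ ⊢f) (⊢-subT ⊢σ ⊢g)
  ⊢wf-subF ⊢σ top         = top
  ⊢wf-subF ⊢σ bot         = bot
  ⊢wf-subF ⊢σ (and wφ wψ) = and (⊢wf-subF ⊢σ wφ) (⊢wf-subF ⊢σ wψ)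
  ⊢wf-subF ⊢σ (or wφ wψ)  = or (⊢wf-subF ⊢σ wφ) (⊢wf-subF ⊢σ wψ)
  ⊢wf-subF ⊢σ (imp wφ wψ) = imp (⊢wf-subF ⊢σ wφ) (⊢wf-subF ⊢σ wψ)
  ⊢wf-subF ⊢σ (all ⊢W wP) = all (⊢s-subS ⊢σ ⊢W) (⊢wf-subF (⊢ₛ-exts ⊢σ) wP)
  ⊢wf-subF ⊢σ (ex ⊢W wP)  = ex (⊢s-subS ⊢σ ⊢W) (⊢wf-subF (⊢ₛ-exts ⊢σ) wP)

  ⊢ₛ-∷ : Γ ⊢ t ∶ subS σ W → Γ ⊢ₛ σ ∶ Δ → Γ ⊢ₛ t ∷ˢ σ ∶ (W ∷ Δ)
  ⊢ₛ-∷ {t = t} {σ = σ} {W = W} ⊢t ⊢σ here =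
    subst (_ ⊢ t ∶_) (sym (subS-wk (t ∷ˢ σ) W)) ⊢t
  ⊢ₛ-∷ {t = t} {σ = σ} ⊢t ⊢σ (there {W = W′} x) =
    subst (_ ⊢ σ _ ∶_) (sym (subS-wk (t ∷ˢ σ) W′)) (⊢σ x)

  ⊢ₛ-sub0 : Γ ⊢ t ∶ W → Γ ⊢ₛ sub0 t ∶ (W ∷ Γ)
  ⊢ₛ-sub0 {t = t} {W = W} ⊢t here = subst (_ ⊢ t ∶_) (sym (subS-sub0-wk t W)) ⊢t
  ⊢ₛ-sub0 {t = t} ⊢t (there {W = W′} x) = subst (_ ⊢ _ ∶_) (sym (subS-sub0-wk t W′)) (var x)

  ⊢ₛ-wk : (W ∷ Γ) ⊢ₛ ren suc ∶ Γ
  ⊢ₛ-wk {V = V} x = subst (_ ⊢ _ ∶_) (renS-as-subS suc V) (var (there x))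

  ⊢wf-wkF : Γ ⊢wf φ → (W ∷ Γ) ⊢wf wkF φ
  ⊢wf-wkF {φ = φ} wφ = subst (_ ⊢wf_) (sym (renF-as-subF suc φ)) (⊢wf-subF ⊢ₛ-wk wφ)

  ∋-unique : Γ ∋ n ∶ W → Γ ∋ n ∶ W′ → W ≡ W′
  ∋-unique here      here      = refl
  ∋-unique (there x) (there y) = cong (renS suc) (∋-unique x y)

  ⊢-unique : Γ ⊢ t ∶ W → Γ ⊢ t ∶ W′ → W ≡ W′
  ⊢-unique (var x)      (var y)        = ∋-unique x y
  ⊢-unique (ocon c)     (ocon .c)      = refl
  ⊢-unique (acon a)     (acon .a)      = refl
  ⊢-unique (idt _)      (idt _)        = refl
  ⊢-unique (comp ⊢f ⊢g) (comp ⊢f′ ⊢g′) with ⊢-unique ⊢f ⊢f′ | ⊢-unique ⊢g ⊢g′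
  ... | refl | refl = refl

  closed-obj : [] ⊢ X ∶ obj → Σ ObjC λ c → X ≡ ocon c
  closed-obj (var ())
  closed-obj (ocon c) = c , refl

  closed-arr : [] ⊢ f ∶ arr X Y → ∃₂ λ c d → X ≡ ocon c × Y ≡ ocon d
  closed-arr (var ())
  closed-arr (acon a) = dom a , cod a , refl , refl
  closed-arr (idt ⊢X) with closed-obj ⊢X
  ... | c , X≡c = c , c , X≡c , X≡c
  closed-arr (comp ⊢f ⊢g) with closed-arr ⊢f | closed-arr ⊢g
  ... | c , _ , X≡c , _ | _ , d , _ , Z≡d = c , d , X≡c , Z≡d

  Der-subst : (∀ {σ φ} → A φ → A′ (subF σ φ))
            → Der A Δ Φ ψ → Γ ⊢ₛ σ ∶ Δ → Der A′ Γ (map (subF σ) Φ) (subF σ ψ)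
  Der-subst Aσ (hyp m)        ⊢σ = hyp (∈-map⁺ _ m)
  Der-subst Aσ (ax a)         ⊢σ = ax (Aσ a)
  Der-subst Aσ ⊤I             ⊢σ = ⊤I
  Der-subst Aσ (⊥E w d)       ⊢σ = ⊥E (⊢wf-subF ⊢σ w) (Der-subst Aσ d ⊢σ)
  Der-subst Aσ (∧I d e)       ⊢σ = ∧I (Der-subst Aσ d ⊢σ) (Der-subst Aσ e ⊢σ)
  Der-subst Aσ (∧E₁ d)        ⊢σ = ∧E₁ (Der-subst Aσ d ⊢σ)
  Der-subst Aσ (∧E₂ d)        ⊢σ = ∧E₂ (Der-subst Aσ d ⊢σ)
  Der-subst Aσ (∨I₁ w d)      ⊢σ = ∨I₁ (⊢wf-subF ⊢σ w) (Der-subst Aσ d ⊢σ)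
  Der-subst Aσ (∨I₂ w d)      ⊢σ = ∨I₂ (⊢wf-subF ⊢σ w) (Der-subst Aσ d ⊢σ)
  Der-subst Aσ (∨E d e₁ e₂)   ⊢σ = ∨E (Der-subst Aσ d ⊢σ) (Der-subst Aσ e₁ ⊢σ) (Der-subst Aσ e₂ ⊢σ)
  Der-subst Aσ (⇒I w d)       ⊢σ = ⇒I (⊢wf-subF ⊢σ w) (Der-subst Aσ d ⊢σ)
  Der-subst Aσ (⇒E d e)       ⊢σ = ⇒E (Der-subst Aσ d ⊢σ) (Der-subst Aσ e ⊢σ)
  Der-subst {A′ = A′} {Φ = Φ} {σ = σ} Aσ (∀I ⊢W d) ⊢σ =
    ∀I (⊢s-subS ⊢σ ⊢W)
       (subst (λ Ψ → Der A′ _ Ψ _) (map-subF-exts-wk σ Φ) (Der-subst Aσ d (⊢ₛ-exts ⊢σ)))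
  Der-subst {A′ = A′} {σ = σ} Aσ (∀E {P = P} {t} d ⊢t) ⊢σ =
    subst (Der A′ _ _) (sym (subF-sub0 σ t P)) (∀E (Der-subst Aσ d ⊢σ) (⊢-subT ⊢σ ⊢t))
  Der-subst {A′ = A′} {σ = σ} Aσ (∃I {P = P} {t} ⊢W wP ⊢t d) ⊢σ =
    ∃I (⊢s-subS ⊢σ ⊢W) (⊢wf-subF (⊢ₛ-exts ⊢σ) wP) (⊢-subT ⊢σ ⊢t)
       (subst (Der A′ _ _) (subF-sub0 σ t P) (Der-subst Aσ d ⊢σ))
  Der-subst {A′ = A′} {Φ = Φ} {σ = σ} Aσ (∃E {P = P} {χ} d wχ e) ⊢σ =
    ∃E (Der-subst Aσ d ⊢σ) (⊢wf-subF ⊢σ wχ)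
       (subst₂ (λ Ψ ξ → Der A′ _ (subF (exts σ) P ∷ Ψ) ξ)
               (map-subF-exts-wk σ Φ) (subF-exts-wk σ χ) (Der-subst Aσ e (⊢ₛ-exts ⊢σ)))
  Der-subst Aσ (≐refl ⊢f)     ⊢σ = ≐refl (⊢-subT ⊢σ ⊢f)
  Der-subst Aσ (≐sym d)       ⊢σ = ≐sym (Der-subst Aσ d ⊢σ)
  Der-subst Aσ (≐trans d e)   ⊢σ = ≐trans (Der-subst Aσ d ⊢σ) (Der-subst Aσ e ⊢σ)
  Der-subst Aσ (≐comp ⊢f ⊢g d e) ⊢σ =
    ≐comp (⊢-subT ⊢σ ⊢f) (⊢-subT ⊢σ ⊢g) (Der-subst Aσ d ⊢σ) (Der-subst Aσ e ⊢σ)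

  cut-hyps : All (Γ ⊢wf_) Φ → Der A Γ Φ ψ → All (Der A Γ []) Φ → Der A Γ [] ψ
  cut-hyps []         d []         = d
  cut-hyps (wφ ∷ wΦ) d (dφ ∷ dΦ) = ⇒E (cut-hyps wΦ (⇒I wφ d) dΦ) dφ

  ⊢wf-map-wkF : All (Γ ⊢wf_) Φ → All (W ∷ Γ ⊢wf_) (map wkF Φ)
  ⊢wf-map-wkF wΦ = map⁺ (All.map ⊢wf-wkF wΦ)

  Der-⊢wf : All (Γ ⊢wf_) Φ → Der NoAxioms Γ Φ ψ → Γ ⊢wf ψ
  Der-⊢wf wΦ (hyp m)      = All.lookup wΦ m
  Der-⊢wf wΦ (ax ())
  Der-⊢wf wΦ ⊤I           = top
  Der-⊢wf wΦ (⊥E w _)     = w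
  Der-⊢wf wΦ (∧I d e)     = and (Der-⊢wf wΦ d) (Der-⊢wf wΦ e)
  Der-⊢wf wΦ (∧E₁ d) with Der-⊢wf wΦ d
  ... | and wφ _ = wφ
  Der-⊢wf wΦ (∧E₂ d) with Der-⊢wf wΦ d
  ... | and _ wψ = wψ
  Der-⊢wf wΦ (∨I₁ wψ d)   = or (Der-⊢wf wΦ d) wψ
  Der-⊢wf wΦ (∨I₂ wφ d)   = or wφ (Der-⊢wf wΦ d)
  Der-⊢wf wΦ (∨E d e _) with Der-⊢wf wΦ d
  ... | or wφ _ = Der-⊢wf (wφ ∷ wΦ) e
  Der-⊢wf wΦ (⇒I wφ d)    = imp wφ (Der-⊢wf (wφ ∷ wΦ) d)
  Der-⊢wf wΦ (⇒E d _) with Der-⊢wf wΦ d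
  ... | imp _ wψ = wψ
  Der-⊢wf wΦ (∀I ⊢W d)    = all ⊢W (Der-⊢wf (⊢wf-map-wkF wΦ) d)
  Der-⊢wf wΦ (∀E d ⊢t) with Der-⊢wf wΦ d
  ... | all _ wP = ⊢wf-subF (⊢ₛ-sub0 ⊢t) wP
  Der-⊢wf wΦ (∃I ⊢W wP _ _) = ex ⊢W wP
  Der-⊢wf wΦ (∃E _ wχ _)  = wχ
  Der-⊢wf wΦ (≐refl ⊢f)   = eq ⊢f ⊢f
  Der-⊢wf wΦ (≐sym d) with Der-⊢wf wΦ d
  ... | eq ⊢f ⊢g = eq ⊢g ⊢f
  Der-⊢wf wΦ (≐trans d e) with Der-⊢wf wΦ d | Der-⊢wf wΦ e
  ... | eq ⊢f ⊢g | eq ⊢g′ ⊢h with ⊢-unique ⊢g ⊢g′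
  ... | refl = eq ⊢f ⊢h
  Der-⊢wf wΦ (≐comp ⊢f₁ ⊢g₁ d e) with Der-⊢wf wΦ d | Der-⊢wf wΦ e
  ... | eq ⊢f₁′ ⊢f₂ | eq ⊢g₁′ ⊢g₂ with ⊢-unique ⊢f₁ ⊢f₁′ | ⊢-unique ⊢g₁ ⊢g₁′
  ... | refl | refl = eq (comp ⊢f₁ ⊢g₁) (comp ⊢f₂ ⊢g₂)

  module Semantics (T : Fm → Set) (Mo : D.Model S T) where
    open D.Model Mo

    FPf : ℕ → Fm → Set
    FPf = D.FPf S T Mo

    FP : Fm → Set
    FP = D.FP S T Mo

    infix 3 ⊢T_

    ⊢T_ : Fm → Set
    ⊢T φ = Der T [] [] φ

    FPf-refuel : ∀ φ → size φ ≤ m → size φ ≤ n → FPf m φ → FPf n φ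
    FPf-refuel (f ≐ g)   (s≤s _) (s≤s _) x = x
    FPf-refuel ⊤'        (s≤s _) (s≤s _) x = x
    FPf-refuel ⊥'        (s≤s _) (s≤s _) ()
    FPf-refuel (φ ∧' ψ)  (s≤s a) (s≤s b) (x , y) =
      FPf-refuel φ (m+n≤o⇒m≤o _ a) (m+n≤o⇒m≤o _ b) x ,
      FPf-refuel ψ (m+n≤o⇒n≤o _ a) (m+n≤o⇒n≤o _ b) y
    FPf-refuel (φ ∨' ψ)  (s≤s a) (s≤s b) (inj₁ x) =
      inj₁ (FPf-refuel φ (m+n≤o⇒m≤o _ a) (m+n≤o⇒m≤o _ b) x)
    FPf-refuel (φ ∨' ψ)  (s≤s a) (s≤s b) (inj₂ y) =
      inj₂ (FPf-refuel ψ (m+n≤o⇒n≤o _ a) (m+n≤o⇒n≤o _ b) y)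
    FPf-refuel (φ ⇒' ψ)  (s≤s a) (s≤s b) (f , d) =
      FPf-refuel ψ (m+n≤o⇒n≤o _ a) (m+n≤o⇒n≤o _ b) ∘ f ∘ FPf-refuel φ (m+n≤o⇒m≤o _ b) (m+n≤o⇒m≤o _ a)
      , d
    FPf-refuel (all W P) (s≤s a) (s≤s b) (f , d) =
      (λ t ⊢t → FPf-refuel (P [ t ]) (size-[]-≤ P a) (size-[]-≤ P b) (f t ⊢t)) , d
    FPf-refuel (ex W P)  (s≤s a) (s≤s b) (t , ⊢t , x) =
      t , ⊢t , FPf-refuel (P [ t ]) (size-[]-≤ P a) (size-[]-≤ P b) x

    FPf⇒FP : ∀ φ → size φ ≤ n → FPf n φ → FP φ
    FPf⇒FP φ le = FPf-refuel φ le ≤-refl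

    FP⇒FPf : ∀ φ → size φ ≤ n → FP φ → FPf n φ
    FP⇒FPf φ le = FPf-refuel φ ≤-refl le

    -- FP φ unfolds by computation, so it does not determine φ for unification;
    -- the record makes φ inferable from ⊩ φ.
    infix 3.5 ⊩_

    record ⊩_ (φ : Fm) : Set where
      constructor ⟨_⟩
      field forced : FP φ

    open ⊩_ public

    ⊩-∧ : ⊩ φ ∧' ψ ⇔ (⊩ φ × ⊩ ψ)
    ⊩-∧ {φ = φ} {ψ = ψ} = mk⇔
      (λ (⟨ x , y ⟩) → ⟨ FPf⇒FP φ (m≤m+n _ _) x ⟩ , ⟨ FPf⇒FP ψ (m≤n+m _ (size φ)) y ⟩)
      (λ (⟨ x ⟩ , ⟨ y ⟩) → ⟨ FP⇒FPf φ (m≤m+n _ _) x , FP⇒FPf ψ (m≤n+m _ (size φ)) y ⟩)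

    ⊩-∨ : ⊩ φ ∨' ψ ⇔ (⊩ φ ⊎ ⊩ ψ)
    ⊩-∨ {φ = φ} {ψ = ψ} = mk⇔
      (λ (⟨ x ⟩) → Sum.map (⟨_⟩ ∘ FPf⇒FP φ (m≤m+n _ _)) (⟨_⟩ ∘ FPf⇒FP ψ (m≤n+m _ (size φ))) x)
      (λ x → ⟨ Sum.map (FP⇒FPf φ (m≤m+n _ _) ∘ forced) (FP⇒FPf ψ (m≤n+m _ (size φ)) ∘ forced) x ⟩)

    ⊩-⇒ : ⊩ φ ⇒' ψ ⇔ ((⊩ φ → ⊩ ψ) × ⊢T φ ⇒' ψ)
    ⊩-⇒ {φ = φ} {ψ = ψ} = mk⇔
      (λ (⟨ f , d ⟩) → (λ (⟨ x ⟩) → ⟨ FPf⇒FP ψ (m≤n+m _ (size φ)) (f (FP⇒FPf φ (m≤m+n _ _) x)) ⟩)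
                     , d)
      (λ (f , d) → ⟨ (λ x → FP⇒FPf ψ (m≤n+m _ (size φ)) (forced (f ⟨ FPf⇒FP φ (m≤m+n _ _) x ⟩)))
                   , d ⟩)

    ⊩-all : ⊩ all W P ⇔ (((t : Tm) → [] ⊢ t ∶ W → ⊩ P [ t ]) × ⊢T all W P)
    ⊩-all {P = P} = mk⇔
      (λ (⟨ f , d ⟩) → (λ t ⊢t → ⟨ FPf⇒FP (P [ t ]) (size-[]-≤ P ≤-refl) (f t ⊢t) ⟩) , d)
      (λ (f , d) → ⟨ (λ t ⊢t → FP⇒FPf (P [ t ]) (size-[]-≤ P ≤-refl) (forced (f t ⊢t))) , d ⟩)

    ⊩-ex : ⊩ ex W P ⇔ (Σ Tm λ t → [] ⊢ t ∶ W × ⊩ P [ t ])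
    ⊩-ex {P = P} = mk⇔
      (λ (⟨ t , ⊢t , x ⟩) → t , ⊢t , ⟨ FPf⇒FP (P [ t ]) (size-[]-≤ P ≤-refl) x ⟩)
      (λ (t , ⊢t , ⟨ x ⟩) → ⟨ t , ⊢t , FP⇒FPf (P [ t ]) (size-[]-≤ P ≤-refl) x ⟩)

    FP-provable : [] ⊢wf φ → FP φ → ⊢T φ
    FP-provable {φ = φ} = FPf-provable (size φ)
      where
      FPf-provable : ∀ {χ} n → [] ⊢wf χ → FPf n χ → ⊢T χ
      FPf-provable zero    _            ()
      FPf-provable (suc n) (eq _ _)     x             = prov x
      FPf-provable (suc n) top          _             = ⊤I
      FPf-provable (suc n) (and wφ wψ)  (x , y)       = ∧I (FPf-provable n wφ x) (FPf-provable n wψ y)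
      FPf-provable (suc n) (or wφ wψ)   (inj₁ x)      = ∨I₁ wψ (FPf-provable n wφ x)
      FPf-provable (suc n) (or wφ wψ)   (inj₂ y)      = ∨I₂ wφ (FPf-provable n wψ y)
      FPf-provable (suc n) (imp _ _)    (_ , d)       = d
      FPf-provable (suc n) (all _ _)    (_ , d)       = d
      FPf-provable (suc n) (ex ⊢W wP)   (t , ⊢t , x) =
        ∃I ⊢W wP ⊢t (FPf-provable n (⊢wf-subF (⊢ₛ-sub0 ⊢t) wP) x)

    M-reflexive : [] ⊢ f ∶ arr X Y → M f f
    M-reflexive {f = f} ⊢f with closed-arr ⊢f
    ... | c , d , refl , refl = M-refl c d f ⊢f

    M-symmetric : M f g → M g f
    M-symmetric {f = f} {g = g} f~g with sorted f~g
    ... | _ , _ , ⊢f , ⊢g with closed-arr ⊢f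
    ... | c , d , refl , refl = M-sym c d f g ⊢f ⊢g f~g

    M-transitive : M f g → M g h → M f h
    M-transitive {f = f} {g = g} {h = h} f~g g~h with sorted f~g | sorted g~h
    ... | _ , _ , ⊢f , ⊢g | _ , _ , ⊢g′ , ⊢h with ⊢-unique ⊢g ⊢g′
    ... | refl with closed-arr ⊢f
    ... | c , d , refl , refl = M-trans c d f g h ⊢f ⊢g ⊢h f~g g~h

    record Closing (Δ : Ctx) (Φ : List Fm) (σ : ℕ → Tm) : Set where
      field
        well-sorted : [] ⊢ₛ σ ∶ Δ
        hyps-wf     : All (Δ ⊢wf_) Φ
        hyps-hold   : All (⊩_ ∘ subF σ) Φ

    open Closing

    assume : Δ ⊢wf φ → ⊩ subF σ φ → Closing Δ Φ σ → Closing Δ (φ ∷ Φ) σ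
    assume wφ x c = record
      { well-sorted = well-sorted c
      ; hyps-wf     = wφ ∷ hyps-wf c
      ; hyps-hold   = x ∷ hyps-hold c
      }

    bind : [] ⊢ t ∶ subS σ W → Closing Δ Φ σ → Closing (W ∷ Δ) (map wkF Φ) (t ∷ˢ σ)
    bind {t = t} {σ = σ} ⊢t c = record
      { well-sorted = ⊢ₛ-∷ ⊢t (well-sorted c)
      ; hyps-wf     = ⊢wf-map-wkF (hyps-wf c)
      ; hyps-hold   = map⁺ (All.map (subst ⊩_ (sym (subF-wk (t ∷ˢ σ) _))) (hyps-hold c))
      }

    provable : Der NoAxioms Δ Φ ψ → Closing Δ Φ σ → ⊢T subF σ ψ
    provable d c = cut-hyps (map⁺ (All.map (⊢wf-subF ⊢σ) (hyps-wf c)))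
                            (Der-subst (λ ()) d ⊢σ)
                            (map⁺ (All.zipWith (λ (w , x) → FP-provable (⊢wf-subF ⊢σ w) (forced x))
                                               (hyps-wf c , hyps-hold c)))
      where ⊢σ = well-sorted c

    open Equivalence using (to; from)

    sound : Der NoAxioms Δ Φ ψ → Closing Δ Φ σ → ⊩ subF σ ψ
    sound (hyp m)         c = All.lookup (hyps-hold c) m
    sound (ax ())         c
    sound ⊤I              c = ⟨ tt ⟩
    sound (⊥E _ d)        c = ⊥-elim (forced (sound d c))
    sound (∧I d e)        c = from ⊩-∧ (sound d c , sound e c)
    sound (∧E₁ d)         c = proj₁ (to ⊩-∧ (sound d c))
    sound (∧E₂ d)         c = proj₂ (to ⊩-∧ (sound d c))
    sound (∨I₁ _ d)       c = from ⊩-∨ (inj₁ (sound d c))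
    sound (∨I₂ _ d)       c = from ⊩-∨ (inj₂ (sound d c))
    sound (∨E d e₁ e₂)    c with to ⊩-∨ (sound d c) | Der-⊢wf (hyps-wf c) d
    ... | inj₁ x | or wφ _ = sound e₁ (assume wφ x c)
    ... | inj₂ y | or _ wψ = sound e₂ (assume wψ y c)
    sound (⇒I wφ d)       c = from ⊩-⇒ ((λ x → sound d (assume wφ x c)) , provable (⇒I wφ d) c)
    sound (⇒E d e)        c = proj₁ (to ⊩-⇒ (sound d c)) (sound e c)
    sound {σ = σ} (∀I {P = P} ⊢W d) c =
      from ⊩-all ( (λ t ⊢t → subst ⊩_ (sym (subF-exts-sub0 t σ P)) (sound d (bind ⊢t c)))
                 , provable (∀I ⊢W d) c )
    sound {σ = σ} (∀E {P = P} {t} d ⊢t) c =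
      subst ⊩_ (sym (subF-sub0 σ t P))
        (proj₁ (to ⊩-all (sound d c)) (subT σ t) (⊢-subT (well-sorted c) ⊢t))
    sound {σ = σ} (∃I {P = P} {t} _ _ ⊢t d) c =
      from ⊩-ex (subT σ t , ⊢-subT (well-sorted c) ⊢t , subst ⊩_ (subF-sub0 σ t P) (sound d c))
    sound {σ = σ} (∃E {P = P} {χ} d _ e) c with to ⊩-ex (sound d c) | Der-⊢wf (hyps-wf c) d
    ... | t , ⊢t , x | ex _ wP =
      subst ⊩_ (subF-wk (t ∷ˢ σ) χ)
        (sound e (assume wP (subst ⊩_ (subF-exts-sub0 t σ P) x) (bind ⊢t c)))
    sound (≐refl ⊢f)      c = ⟨ M-reflexive (⊢-subT (well-sorted c) ⊢f) ⟩
    sound (≐sym d)        c = ⟨ M-symmetric (forced (sound d c)) ⟩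
    sound (≐trans d e)    c = ⟨ M-transitive (forced (sound d c)) (forced (sound e c)) ⟩
    sound (≐comp ⊢f ⊢g d e) c =
      ⟨ M-comp (⊢-subT (well-sorted c) ⊢f) (⊢-subT (well-sorted c) ⊢g)
               (forced (sound d c)) (forced (sound e c)) ⟩

open import Defs using (Fm; Model; Sentence; Der; NoAxioms; FP)

mainTheorem6 : (S : Sig) (T : Fm S → Set) → (∀ φ → T φ → Sentence S φ)
    → (Mo : Model S T) (φs : List (Fm S)) (ψ : Fm S)
    → All (Sentence S) φs → Sentence S ψ
    → All (FP S T Mo) φs
    → Der S (NoAxioms S) [] φs ψ
    → FP S T Mo ψ
mainTheorem6 S T _ Mo φs ψ sentences _ hold d =
  forced (subst ⊩_ (subF-id ψ) (sound d closing))
  where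
  open Soundness S
  open Semantics T Mo

  closing : Closing [] φs var
  closing = record
    { well-sorted = λ ()
    ; hyps-wf     = sentences
    ; hyps-hold   = All.map (λ {φ} x → subst ⊩_ (sym (subF-id φ)) ⟨ x ⟩) hold
    }
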